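{- Let $p_1,q_1,p_2,q_2$ be non-negative integers with $p_1>0$, $q_2>0$ and $p_1q_2-q_1p_2>0$. If $(X,Y)\in\mathcal{B}_Q$, then $(X,Y)=(x+Ap_1+Bp_2,\ y+Aq_1+Bq_2)$ for some unique $(x,y)\in\mathcal{T}_Q$ and some unique non-negative integers $A$ and $B$.
   Context: Let $\mathcal{B}$ be the set of ordered pairs of non-negative integers. Let $\mathcal{B}_Q=\{(X,Y)\in\mathcal{B}\mid Xq_1\le Yp_1 \text{ and } Yp_2\le Xq_2\}$. Let $\mathcal{T}_Q=\{(x,y)\in\mathcal{B}_Q\mid p_1(y-q_2)<q_1(x-p_2)\text{ and } p_2(y-q_1)>q_2(x-p_1)\}$. -}

module Defs where

open import Data.Nat using (ℕ; _*_; _≤_)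
open import Data.Integer as ℤ using (ℤ; +_)
open import Data.Product using (_×_)

InBQ : (p₁ q₁ p₂ q₂ : ℕ) → ℕ → ℕ → Set
InBQ p₁ q₁ p₂ q₂ X Y = (X * q₁ ≤ Y * p₁) × (Y * p₂ ≤ X * q₂)

InTQ : (p₁ q₁ p₂ q₂ : ℕ) → ℕ → ℕ → Set
InTQ p₁ q₁ p₂ q₂ x y =
  InBQ p₁ q₁ p₂ q₂ x y
  × ((+ p₁) ℤ.* ((+ y) ℤ.- (+ q₂)) ℤ.< (+ q₁) ℤ.* ((+ x) ℤ.- (+ p₂)))
  × ((+ q₂) ℤ.* ((+ x) ℤ.- (+ p₁)) ℤ.< (+ p₂) ℤ.* ((+ y) ℤ.- (+ q₁)))

-- Put D = p₁q₂ − q₁p₂ and α(X,Y) = Xq₂ − Yp₂, β(X,Y) = Yp₁ − Xq₁.  Then B_Q is the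
-- region α, β ≥ 0, and translating (X,Y) by (p₁,q₁) resp. (p₂,q₂) raises α resp. β by D
-- while fixing the other.  T_Q is exactly the region 0 ≤ α, β < D, so writing a point of
-- B_Q as (x,y) + A(p₁,q₁) + B(p₂,q₂) with (x,y) ∈ T_Q amounts to Euclidean division of
-- α(X,Y) and β(X,Y) by D: A and B are the quotients, α(x,y) and β(x,y) the remainders.
-- The translate stays in ℕ² because X·D = α p₁ + β p₂ and Y·D = α q₁ + β q₂.
module Submission where

open import Defs
open import Data.Nat using (ℕ; z≤n; _+_; _*_; _∸_; _<_; _≤_; NonZero; >-nonZero)
import Data.Nat.Properties as ℕ
open import Data.Nat.DivMod using (_/_; _%_; m≡m%n+[m/n]*n; m%n<n; m/n*n≤m; +-distrib-/-∣ʳ; m<n⇒m/n≡0; m*n/n≡m)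
open import Data.Nat.Divisibility using (divides-refl)
import Data.Nat.Tactic.RingSolver as ℕ-Ring
open import Data.Integer as ℤ using (ℤ; +_; 0ℤ; ∣_∣; +≤+; +<+)
import Data.Integer.Properties as ℤ
open import Data.Integer.Tactic.RingSolver using (solve-∀)
open import Algebra.Properties.AbelianGroup ℤ.+-0-abelianGroup using (∙-cancelʳ)
open import Data.Product using (Σ; ∃₂; _×_; _,_; proj₁; proj₂)
open import Function.Bundles using (_⇔_; mk⇔; Equivalence)
open import Relation.Binary.PropositionalEquality using (_≡_; refl; sym; trans; cong; cong₂; subst₂; module ≡-Reasoning)

open Equivalence using (to; from)

pos-∸ : ∀ {m n} → n ≤ m → + (m ∸ n) ≡ + m ℤ.- + n
pos-∸ {m} {n} n≤m = trans (sym (ℤ.⊖-≥ n≤m)) (sym (ℤ.m-n≡m⊖n m n))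

pos-+* : ∀ x a p → + (x + a * p) ≡ + x ℤ.+ + a ℤ.* + p
pos-+* x a p = trans (ℤ.pos-+ x (a * p)) (cong (λ t → + x ℤ.+ t) (ℤ.pos-* a p))

pos-*+* : ∀ a p b q → + (a * p + b * q) ≡ + a ℤ.* + p ℤ.+ + b ℤ.* + q
pos-*+* a p b q = trans (pos-+* (a * p) b q) (cong (ℤ._+ + b ℤ.* + q) (ℤ.pos-* a p))

pos-+*+* : ∀ x a p b q → + (x + a * p + b * q) ≡ + x ℤ.+ + a ℤ.* + p ℤ.+ + b ℤ.* + q
pos-+*+* x a p b q = trans (pos-+* (x + a * p) b q) (cong (ℤ._+ + b ℤ.* + q) (pos-+* x a p))

*≤*⇔0≤*-* : ∀ m n k l → m * n ≤ k * l ⇔ 0ℤ ℤ.≤ + k ℤ.* + l ℤ.- + m ℤ.* + n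
*≤*⇔0≤*-* m n k l = mk⇔
  (λ mn≤kl → subst₂ (λ u v → 0ℤ ℤ.≤ u ℤ.- v) (ℤ.pos-* k l) (ℤ.pos-* m n) (ℤ.i≤j⇒0≤j-i (+≤+ mn≤kl)))
  (λ 0≤kl-mn → ℤ.drop‿+≤+ (subst₂ ℤ._≤_ (sym (ℤ.pos-* m n)) (sym (ℤ.pos-* k l)) (ℤ.0≤i-j⇒j≤i 0≤kl-mn)))

i-j≡k-l⇒i<j⇒k<l : ∀ {i j k l} → i ℤ.- j ≡ k ℤ.- l → i ℤ.< j → k ℤ.< l
i-j≡k-l⇒i<j⇒k<l {i} {j} {k} {l} eq i<j = begin-strict
  k                 ≡⟨ shift k l ⟩
  k ℤ.- l ℤ.+ l     ≡⟨ cong (ℤ._+ l) (sym eq) ⟩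
  i ℤ.- j ℤ.+ l     <⟨ ℤ.+-monoˡ-< l (ℤ.+-monoˡ-< (ℤ.- j) i<j) ⟩
  j ℤ.- j ℤ.+ l     ≡⟨ cancel j l ⟩
  l                 ∎
  where
  open ℤ.≤-Reasoning
  shift : ∀ k l → k ≡ k ℤ.- l ℤ.+ l
  shift = solve-∀
  cancel : ∀ j l → j ℤ.- j ℤ.+ l ≡ l
  cancel = solve-∀

i-j≡k-l⇒i<j⇔k<l : ∀ {i j k l} → i ℤ.- j ≡ k ℤ.- l → i ℤ.< j ⇔ k ℤ.< l
i-j≡k-l⇒i<j⇔k<l eq = mk⇔ (i-j≡k-l⇒i<j⇒k<l eq) (i-j≡k-l⇒i<j⇒k<l (sym eq))

m<n⇒[m+kn]/n≡k : ∀ {m n} k .{{_ : NonZero n}} → m < n → (m + k * n) / n ≡ k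
m<n⇒[m+kn]/n≡k {m} {n} k m<n = begin
  (m + k * n) / n      ≡⟨ +-distrib-/-∣ʳ m (divides-refl k) ⟩
  m / n + k * n / n    ≡⟨ cong₂ _+_ (m<n⇒m/n≡0 m<n) (m*n/n≡m k n) ⟩
  k                    ∎
  where open ≡-Reasoning

a/n*p+b/n*q≤m : ∀ {m a b p q n} .{{_ : NonZero n}} →
  m * n ≡ a * p + b * q → (a / n) * p + (b / n) * q ≤ m
a/n*p+b/n*q≤m {m} {a} {b} {p} {q} {n} mn≡ap+bq = ℕ.*-cancelʳ-≤ _ m n (begin
  ((a / n) * p + (b / n) * q) * n    ≡⟨ regroup (a / n) p (b / n) q n ⟩
  (a / n) * n * p + (b / n) * n * q  ≤⟨ ℕ.+-mono-≤ (ℕ.*-monoˡ-≤ p (m/n*n≤m a n)) (ℕ.*-monoˡ-≤ q (m/n*n≤m b n)) ⟩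
  a * p + b * q                      ≡⟨ sym mn≡ap+bq ⟩
  m * n                              ∎)
  where
  open ℕ.≤-Reasoning
  regroup : ∀ u p v q n → (u * p + v * q) * n ≡ u * n * p + v * n * q
  regroup = ℕ-Ring.solve-∀

module Lattice (p₁ q₁ p₂ q₂ : ℕ) where

  det : ℤ
  det = + p₁ ℤ.* + q₂ ℤ.- + q₁ ℤ.* + p₂

  α β : ℕ → ℕ → ℤ
  α X Y = + X ℤ.* + q₂ ℤ.- + Y ℤ.* + p₂
  β X Y = + Y ℤ.* + p₁ ℤ.- + X ℤ.* + q₁

  Decomposes : (X Y x y A B : ℕ) → Set
  Decomposes X Y x y A B = X ≡ x + A * p₁ + B * p₂ × Y ≡ y + A * q₁ + B * q₂

  α-translate : ∀ {X Y} x y A B → Decomposes X Y x y A B → α X Y ≡ α x y ℤ.+ + A ℤ.* det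
  α-translate x y A B (refl , refl) = begin
    + (x + A * p₁ + B * p₂) ℤ.* + q₂ ℤ.- + (y + A * q₁ + B * q₂) ℤ.* + p₂
      ≡⟨ cong₂ (λ u v → u ℤ.* + q₂ ℤ.- v ℤ.* + p₂) (pos-+*+* x A p₁ B p₂) (pos-+*+* y A q₁ B q₂) ⟩
    (+ x ℤ.+ + A ℤ.* + p₁ ℤ.+ + B ℤ.* + p₂) ℤ.* + q₂ ℤ.- (+ y ℤ.+ + A ℤ.* + q₁ ℤ.+ + B ℤ.* + q₂) ℤ.* + p₂
      ≡⟨ linear (+ x) (+ y) (+ A) (+ B) (+ p₁) (+ q₁) (+ p₂) (+ q₂) ⟩
    α x y ℤ.+ + A ℤ.* det  ∎
    where
    open ≡-Reasoning
    linear : ∀ x y A B p₁ q₁ p₂ q₂ →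
      (x ℤ.+ A ℤ.* p₁ ℤ.+ B ℤ.* p₂) ℤ.* q₂ ℤ.- (y ℤ.+ A ℤ.* q₁ ℤ.+ B ℤ.* q₂) ℤ.* p₂
        ≡ (x ℤ.* q₂ ℤ.- y ℤ.* p₂) ℤ.+ A ℤ.* (p₁ ℤ.* q₂ ℤ.- q₁ ℤ.* p₂)
    linear = solve-∀

  β-translate : ∀ {X Y} x y A B → Decomposes X Y x y A B → β X Y ≡ β x y ℤ.+ + B ℤ.* det
  β-translate x y A B (refl , refl) = begin
    + (y + A * q₁ + B * q₂) ℤ.* + p₁ ℤ.- + (x + A * p₁ + B * p₂) ℤ.* + q₁
      ≡⟨ cong₂ (λ u v → v ℤ.* + p₁ ℤ.- u ℤ.* + q₁) (pos-+*+* x A p₁ B p₂) (pos-+*+* y A q₁ B q₂) ⟩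
    (+ y ℤ.+ + A ℤ.* + q₁ ℤ.+ + B ℤ.* + q₂) ℤ.* + p₁ ℤ.- (+ x ℤ.+ + A ℤ.* + p₁ ℤ.+ + B ℤ.* + p₂) ℤ.* + q₁
      ≡⟨ linear (+ x) (+ y) (+ A) (+ B) (+ p₁) (+ q₁) (+ p₂) (+ q₂) ⟩
    β x y ℤ.+ + B ℤ.* det  ∎
    where
    open ≡-Reasoning
    linear : ∀ x y A B p₁ q₁ p₂ q₂ →
      (y ℤ.+ A ℤ.* q₁ ℤ.+ B ℤ.* q₂) ℤ.* p₁ ℤ.- (x ℤ.+ A ℤ.* p₁ ℤ.+ B ℤ.* p₂) ℤ.* q₁
        ≡ (y ℤ.* p₁ ℤ.- x ℤ.* q₁) ℤ.+ B ℤ.* (p₁ ℤ.* q₂ ℤ.- q₁ ℤ.* p₂)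
    linear = solve-∀

  X*det≡αp₁+βp₂ : ∀ X Y → + X ℤ.* det ≡ α X Y ℤ.* + p₁ ℤ.+ β X Y ℤ.* + p₂
  X*det≡αp₁+βp₂ X Y = cramer (+ X) (+ Y) (+ p₁) (+ q₁) (+ p₂) (+ q₂)
    where
    cramer : ∀ X Y p₁ q₁ p₂ q₂ → X ℤ.* (p₁ ℤ.* q₂ ℤ.- q₁ ℤ.* p₂)
      ≡ (X ℤ.* q₂ ℤ.- Y ℤ.* p₂) ℤ.* p₁ ℤ.+ (Y ℤ.* p₁ ℤ.- X ℤ.* q₁) ℤ.* p₂
    cramer = solve-∀

  Y*det≡αq₁+βq₂ : ∀ X Y → + Y ℤ.* det ≡ α X Y ℤ.* + q₁ ℤ.+ β X Y ℤ.* + q₂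
  Y*det≡αq₁+βq₂ X Y = cramer (+ X) (+ Y) (+ p₁) (+ q₁) (+ p₂) (+ q₂)
    where
    cramer : ∀ X Y p₁ q₁ p₂ q₂ → Y ℤ.* (p₁ ℤ.* q₂ ℤ.- q₁ ℤ.* p₂)
      ≡ (X ℤ.* q₂ ℤ.- Y ℤ.* p₂) ℤ.* q₁ ℤ.+ (Y ℤ.* p₁ ℤ.- X ℤ.* q₁) ℤ.* q₂
    cramer = solve-∀

  InBQ⇔ : ∀ x y → InBQ p₁ q₁ p₂ q₂ x y ⇔ (0ℤ ℤ.≤ β x y × 0ℤ ℤ.≤ α x y)
  InBQ⇔ x y = mk⇔
    (λ (xq₁≤yp₁ , yp₂≤xq₂) → to (*≤*⇔0≤*-* x q₁ y p₁) xq₁≤yp₁ , to (*≤*⇔0≤*-* y p₂ x q₂) yp₂≤xq₂)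
    (λ (0≤β , 0≤α) → from (*≤*⇔0≤*-* x q₁ y p₁) 0≤β , from (*≤*⇔0≤*-* y p₂ x q₂) 0≤α)

  below₁⇔β<det : ∀ x y →
    + p₁ ℤ.* (+ y ℤ.- + q₂) ℤ.< + q₁ ℤ.* (+ x ℤ.- + p₂) ⇔ β x y ℤ.< det
  below₁⇔β<det x y = i-j≡k-l⇒i<j⇔k<l (expand (+ x) (+ y) (+ p₁) (+ q₁) (+ p₂) (+ q₂))
    where
    expand : ∀ x y p₁ q₁ p₂ q₂ → p₁ ℤ.* (y ℤ.- q₂) ℤ.- q₁ ℤ.* (x ℤ.- p₂)
      ≡ (y ℤ.* p₁ ℤ.- x ℤ.* q₁) ℤ.- (p₁ ℤ.* q₂ ℤ.- q₁ ℤ.* p₂)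
    expand = solve-∀

  below₂⇔α<det : ∀ x y →
    + q₂ ℤ.* (+ x ℤ.- + p₁) ℤ.< + p₂ ℤ.* (+ y ℤ.- + q₁) ⇔ α x y ℤ.< det
  below₂⇔α<det x y = i-j≡k-l⇒i<j⇔k<l (expand (+ x) (+ y) (+ p₁) (+ q₁) (+ p₂) (+ q₂))
    where
    expand : ∀ x y p₁ q₁ p₂ q₂ → q₂ ℤ.* (x ℤ.- p₁) ℤ.- p₂ ℤ.* (y ℤ.- q₁)
      ≡ (x ℤ.* q₂ ℤ.- y ℤ.* p₂) ℤ.- (p₁ ℤ.* q₂ ℤ.- q₁ ℤ.* p₂)
    expand = solve-∀

module Decomposition (p₁ q₁ p₂ q₂ : ℕ) (q₁p₂<p₁q₂ : q₁ * p₂ < p₁ * q₂) where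

  open Lattice p₁ q₁ p₂ q₂

  D : ℕ
  D = p₁ * q₂ ∸ q₁ * p₂

  instance
    D-nonZero : NonZero D
    D-nonZero = >-nonZero (ℕ.m<n⇒0<n∸m q₁p₂<p₁q₂)

  det≡D : det ≡ + D
  det≡D = sym (trans (pos-∸ (ℕ.<⇒≤ q₁p₂<p₁q₂)) (cong₂ ℤ._-_ (ℤ.pos-* p₁ q₂) (ℤ.pos-* q₁ p₂)))

  Residue : ℤ → Set
  Residue i = Σ ℕ λ r → i ≡ + r × r < D

  InTQ⇔ : ∀ x y → InTQ p₁ q₁ p₂ q₂ x y ⇔ (Residue (β x y) × Residue (α x y))
  InTQ⇔ x y = mk⇔
    (λ (xy∈BQ , below₁ , below₂) →
      residue (proj₁ (to (InBQ⇔ x y) xy∈BQ)) (to (below₁⇔β<det x y) below₁)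
      , residue (proj₂ (to (InBQ⇔ x y) xy∈BQ)) (to (below₂⇔α<det x y) below₂))
    (λ (β-residue , α-residue) →
      from (InBQ⇔ x y) (nonNegative β-residue , nonNegative α-residue)
      , from (below₁⇔β<det x y) (below-det β-residue) , from (below₂⇔α<det x y) (below-det α-residue))
    where
    residue : ∀ {i} → 0ℤ ℤ.≤ i → i ℤ.< det → Residue i
    residue {i} 0≤i i<det = ∣ i ∣ , sym +∣i∣≡i
      , ℤ.drop‿+<+ (subst₂ ℤ._<_ (sym +∣i∣≡i) det≡D i<det)
      where
      +∣i∣≡i : + ∣ i ∣ ≡ i
      +∣i∣≡i = ℤ.0≤i⇒+∣i∣≡i 0≤i
    nonNegative : ∀ {i} → Residue i → 0ℤ ℤ.≤ i
    nonNegative (_ , refl , _) = +≤+ z≤n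
    below-det : ∀ {i} → Residue i → i ℤ.< det
    below-det (_ , refl , r<D) = subst₂ ℤ._<_ refl (sym det≡D) (+<+ r<D)

  quotient-unique : ∀ {i j A A′} → Residue i → Residue j →
    i ℤ.+ + A ℤ.* + D ≡ j ℤ.+ + A′ ℤ.* + D → A ≡ A′
  quotient-unique {A = A} {A′} (r , refl , r<D) (s , refl , s<D) eq = begin
    A                  ≡⟨ sym (m<n⇒[m+kn]/n≡k A r<D) ⟩
    (r + A * D) / D    ≡⟨ cong (_/ D) (ℤ.+-injective (trans (pos-+* r A D) (trans eq (sym (pos-+* s A′ D))))) ⟩
    (s + A′ * D) / D   ≡⟨ m<n⇒[m+kn]/n≡k A′ s<D ⟩
    A′                 ∎
    where open ≡-Reasoning

  α-decomposition : ∀ {X Y} x y A B → Decomposes X Y x y A B → α X Y ≡ α x y ℤ.+ + A ℤ.* + D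
  α-decomposition x y A B dec = trans (α-translate x y A B dec) (cong (λ d → α x y ℤ.+ + A ℤ.* d) det≡D)

  β-decomposition : ∀ {X Y} x y A B → Decomposes X Y x y A B → β X Y ≡ β x y ℤ.+ + B ℤ.* + D
  β-decomposition x y A B dec = trans (β-translate x y A B dec) (cong (λ d → β x y ℤ.+ + B ℤ.* d) det≡D)

  decomposition-unique : ∀ {X Y x y A B x′ y′ A′ B′} →
    InTQ p₁ q₁ p₂ q₂ x y → InTQ p₁ q₁ p₂ q₂ x′ y′ →
    Decomposes X Y x y A B → Decomposes X Y x′ y′ A′ B′ →
    x′ ≡ x × y′ ≡ y × A′ ≡ A × B′ ≡ B
  decomposition-unique {x = x} {y} {A} {B} {x′} {y′} {A′} {B′} xy∈TQ x′y′∈TQ (X≡ , Y≡) (X≡′ , Y≡′) =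
    x′≡x , y′≡y , A′≡A , B′≡B
    where
    A′≡A : A′ ≡ A
    A′≡A = quotient-unique (proj₂ (to (InTQ⇔ x′ y′) x′y′∈TQ)) (proj₂ (to (InTQ⇔ x y) xy∈TQ))
      (trans (sym (α-decomposition x′ y′ A′ B′ (X≡′ , Y≡′))) (α-decomposition x y A B (X≡ , Y≡)))
    B′≡B : B′ ≡ B
    B′≡B = quotient-unique (proj₁ (to (InTQ⇔ x′ y′) x′y′∈TQ)) (proj₁ (to (InTQ⇔ x y) xy∈TQ))
      (trans (sym (β-decomposition x′ y′ A′ B′ (X≡′ , Y≡′))) (β-decomposition x y A B (X≡ , Y≡)))
    offset-injective : ∀ {u u′ c d} → u′ + c + d ≡ u + c + d → u′ ≡ u
    offset-injective {c = c} {d} eq = ℕ.+-cancelʳ-≡ c _ _ (ℕ.+-cancelʳ-≡ d _ _ eq)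
    x′≡x : x′ ≡ x
    x′≡x = offset-injective
      (trans (cong₂ (λ u v → x′ + u * p₁ + v * p₂) (sym A′≡A) (sym B′≡B)) (trans (sym X≡′) X≡))
    y′≡y : y′ ≡ y
    y′≡y = offset-injective
      (trans (cong₂ (λ u v → y′ + u * q₁ + v * q₂) (sym A′≡A) (sym B′≡B)) (trans (sym Y≡′) Y≡))

  decomposition-exists : ∀ X Y → InBQ p₁ q₁ p₂ q₂ X Y →
    ∃₂ λ x y → ∃₂ λ A B → InTQ p₁ q₁ p₂ q₂ x y × Decomposes X Y x y A B
  decomposition-exists X Y XY∈BQ =
    x , y , A , B , from (InTQ⇔ x y) (β-residue , α-residue) , (X≡ , Y≡)
    where
    a b A B : ℕ
    a = ∣ α X Y ∣
    b = ∣ β X Y ∣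
    A = a / D
    B = b / D
    +a≡α : + a ≡ α X Y
    +a≡α = ℤ.0≤i⇒+∣i∣≡i (proj₂ (to (InBQ⇔ X Y) XY∈BQ))
    +b≡β : + b ≡ β X Y
    +b≡β = ℤ.0≤i⇒+∣i∣≡i (proj₁ (to (InBQ⇔ X Y) XY∈BQ))
    Z*D≡au+bv : ∀ Z u v → + Z ℤ.* det ≡ α X Y ℤ.* + u ℤ.+ β X Y ℤ.* + v → Z * D ≡ a * u + b * v
    Z*D≡au+bv Z u v Zdet≡ = ℤ.+-injective (begin
      + (Z * D)                           ≡⟨ ℤ.pos-* Z D ⟩
      + Z ℤ.* + D                         ≡⟨ cong (+ Z ℤ.*_) (sym det≡D) ⟩
      + Z ℤ.* det                         ≡⟨ Zdet≡ ⟩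
      α X Y ℤ.* + u ℤ.+ β X Y ℤ.* + v     ≡⟨ cong₂ (λ i j → i ℤ.* + u ℤ.+ j ℤ.* + v) (sym +a≡α) (sym +b≡β) ⟩
      + a ℤ.* + u ℤ.+ + b ℤ.* + v         ≡⟨ sym (pos-*+* a u b v) ⟩
      + (a * u + b * v)                   ∎)
      where open ≡-Reasoning
    x y : ℕ
    x = X ∸ (A * p₁ + B * p₂)
    y = Y ∸ (A * q₁ + B * q₂)
    X≡ : X ≡ x + A * p₁ + B * p₂
    X≡ = sym (trans (ℕ.+-assoc x _ _) (ℕ.m∸n+n≡m (a/n*p+b/n*q≤m (Z*D≡au+bv X p₁ p₂ (X*det≡αp₁+βp₂ X Y)))))
    Y≡ : Y ≡ y + A * q₁ + B * q₂
    Y≡ = sym (trans (ℕ.+-assoc y _ _) (ℕ.m∸n+n≡m (a/n*p+b/n*q≤m (Z*D≡au+bv Y q₁ q₂ (Y*det≡αq₁+βq₂ X Y)))))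
    remainder : ∀ {i c} → + c ≡ i ℤ.+ + (c / D) ℤ.* + D → i ≡ + (c % D)
    remainder {i} {c} c≡ = ∙-cancelʳ (+ (c / D) ℤ.* + D) i (+ (c % D))
      (trans (sym c≡) (trans (cong +_ (m≡m%n+[m/n]*n c D)) (pos-+* (c % D) (c / D) D)))
    α-residue : Residue (α x y)
    α-residue = a % D , remainder (trans +a≡α (α-decomposition x y A B (X≡ , Y≡))) , m%n<n a D
    β-residue : Residue (β x y)
    β-residue = b % D , remainder (trans +b≡β (β-decomposition x y A B (X≡ , Y≡))) , m%n<n b D

-- The hypotheses 0 < p₁ and 0 < q₂ are implied by q₁p₂ < p₁q₂.
lemma3 : (p₁ q₁ p₂ q₂ : ℕ) → 0 < p₁ → 0 < q₂ → q₁ * p₂ < p₁ * q₂ →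
    (X Y : ℕ) → InBQ p₁ q₁ p₂ q₂ X Y →
    Σ (ℕ × ℕ × ℕ × ℕ) (λ { (x , y , A , B) →
      (InTQ p₁ q₁ p₂ q₂ x y × X ≡ x + A * p₁ + B * p₂ × Y ≡ y + A * q₁ + B * q₂)
      × ((x′ y′ A′ B′ : ℕ) → InTQ p₁ q₁ p₂ q₂ x′ y′ →
          X ≡ x′ + A′ * p₁ + B′ * p₂ → Y ≡ y′ + A′ * q₁ + B′ * q₂ →
          (x′ ≡ x × y′ ≡ y × A′ ≡ A × B′ ≡ B)) })
lemma3 p₁ q₁ p₂ q₂ _ _ q₁p₂<p₁q₂ X Y XY∈BQ =
  let open Decomposition p₁ q₁ p₂ q₂ q₁p₂<p₁q₂
      (x , y , A , B , xy∈TQ , decomposition) = decomposition-exists X Y XY∈BQ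
  in (x , y , A , B) , (xy∈TQ , decomposition) ,
     λ x′ y′ A′ B′ x′y′∈TQ X≡′ Y≡′ → decomposition-unique xy∈TQ x′y′∈TQ decomposition (X≡′ , Y≡′)
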